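{- Let $q$ be a power of an odd prime with $q\equiv 3\pmod 4$, let $r$ be a positive integer, $u\in\mathbb{F}_q$, and $F_{r,u}(x)=x^r\big(1+u\eta(x)\big)$. For any $a\in\mathbb{F}_q^*$ and $b\in\mathbb{F}_q$, $\delta_{F_{r,-u}}(a,b)=\delta_{F_{r,u}}\big(a,\frac{b}{(-1)^{r+1}}\big)$ and $\beta_{F_{r,-u}}(a,b)=\beta_{F_{r,u}}\big(a,\frac{b}{(-1)^{r}}\big)$. In particular, $F_{r,u}$ and $F_{r,-u}$ have the same differential spectrum and the same boomerang spectrum.
   Context: $\eta$ is the quadratic character of $\mathbb{F}_q$ ($\eta(0)=0$, $\eta=1$ on nonzero squares, $-1$ on non-squares). For $f$ on $\mathbb{F}_q$: $\delta_f(a,b)=\#\{x: f(x+a)-f(x)=b\}$; $\beta_f(a,b)$ is the number of $(x,y)\in\mathbb{F}_q^2$ with $f(x)-f(y)=b$ and $f(x+a)-f(y+a)=b$. The differential spectrum is the multiset of $\omega_i=\#\{(a,b)\in\mathbb{F}_q^*\times\mathbb{F}_q:\delta_f(a,b)=i\}$, the boomerang spectrum the multiset of $\nu_i=\#\{(a,b)\in\mathbb{F}_q^*\times\mathbb{F}_q^*:\beta_f(a,b)=i\}$. -}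

module Defs where

open import Level using (0ℓ)
open import Data.Nat as ℕ using (ℕ; zero; suc; _%_)
open import Data.Nat.Primality using (Prime)
open import Data.List using (List; length; filter; cartesianProduct)
open import Data.List.Membership.Propositional using (_∈_)
open import Data.List.Relation.Unary.Unique.Propositional using (Unique)
open import Data.List.Relation.Unary.Any using (any?)
open import Data.Product using (_×_; _,_; ∃; ∃-syntax)
open import Relation.Binary.PropositionalEquality using (_≡_; _≢_)
open import Relation.Binary.Definitions using (DecidableEquality)
open import Relation.Nullary using (Dec; yes; no; ¬_)
open import Relation.Nullary.Decidable using (¬?; _×-dec_)
open import Algebra.Structures using (IsCommutativeRing)

record FiniteField : Set₁ where
  infixl 7 _*_
  infixl 6 _+_ _-_
  field
    Carrier : Set
    _≟_ : DecidableEquality Carrier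
    _+_ _*_ : Carrier → Carrier → Carrier
    -_ : Carrier → Carrier
    0# 1# : Carrier
    isCommutativeRing : IsCommutativeRing _≡_ _+_ _*_ -_ 0# 1#
    _⁻¹ : Carrier → Carrier
    ⁻¹-inverse : ∀ x → x ≢ 0# → x * (x ⁻¹) ≡ 1#
    0≢1 : 0# ≢ 1#
    elements : List Carrier
    complete : ∀ x → x ∈ elements
    unique : Unique elements

  _-_ : Carrier → Carrier → Carrier
  x - y = x + (- y)

  order : ℕ
  order = length elements

  infixr 8 _^_
  _^_ : Carrier → ℕ → Carrier
  x ^ zero = 1#
  x ^ suc n = x * (x ^ n)

  η : Carrier → Carrier
  η x with x ≟ 0#
  ... | yes _ = 0#
  ... | no _ with any? (λ y → (y * y) ≟ x) elements
  ...   | yes _ = 1#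
  ...   | no _ = - 1#

  F : ℕ → Carrier → Carrier → Carrier
  F r u x = (x ^ r) * (1# + u * η x)

  δ : (Carrier → Carrier) → Carrier → Carrier → ℕ
  δ f a b = length (filter (λ x → (f (x + a) - f x) ≟ b) elements)

  β : (Carrier → Carrier) → Carrier → Carrier → ℕ
  β f a b = length (filter (λ { (x , y) → ((f x - f y) ≟ b) ×-dec ((f (x + a) - f (y + a)) ≟ b) })
                           (cartesianProduct elements elements))

  ω : (Carrier → Carrier) → ℕ → ℕ
  ω f i = length (filter (λ { (a , b) → ¬? (a ≟ 0#) ×-dec (δ f a b ℕ.≟ i) })
                         (cartesianProduct elements elements))

  ν : (Carrier → Carrier) → ℕ → ℕ
  ν f i = length (filter (λ { (a , b) → (¬? (a ≟ 0#) ×-dec ¬? (b ≟ 0#)) ×-dec (β f a b ℕ.≟ i) })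
                         (cartesianProduct elements elements))

module Submission where

-- As soon as η is odd, η (- x) = - η x, the substitution x ↦ - x turns F r u into
-- (- 1) ^ r * F r (- u).  Then x ↦ - (x + a), applied to x (for δ) or to both x and y (for β),
-- is a bijection between the solution sets counted for the two functions, with b rescaled by a
-- sign; rescaling b also matches up the spectra.
--
-- That η is odd is where q ≡ 3 (mod 4) enters.  For x ≠ 0 the involution y ↦ x / y of F_q^* pairs
-- up all elements except the square roots of x, so the product of all elements of F_q^* equals
-- - η x * x ^ h with h = (q - 1) / 2 (Wilson's theorem and Euler's criterion at once).  Comparing
-- x with - x, and using that h is odd, gives η (- x) = - η x.  The characteristic is odd because
-- translation by 1 would otherwise be a fixed-point-free involution of F_q, making q even.

open import Algebra.Bundles using (CommutativeRing)
import Algebra.Properties.AbelianGroup as AbelianGroupProperties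
import Algebra.Properties.Ring as RingProperties
import Algebra.Solver.CommutativeMonoid as CommutativeMonoidSolver
open import Data.List using (List; []; _∷_; _++_; length; filter; map; foldr; concatMap; cartesianProduct)
open import Data.List.Membership.Propositional using (_∈_; lose)
open import Data.List.Membership.Propositional.Properties
  using (∈-filter⁺; ∈-filter⁻; ∈-map⁺; ∈-map⁻; ∈-cartesianProduct⁺)
open import Data.List.Membership.Propositional.Properties.WithK using (unique∧set⇒bag)
open import Data.List.Properties
  using (length-map; length-++; length-filter; filter-reject; filter-none; ++-identityʳ)
open import Data.List.Relation.Binary.BagAndSetEquality using (∼bag⇒↭)
open import Data.List.Relation.Binary.Permutation.Propositional
  using (_↭_; ↭-refl; prep; ↭⇒↭ₛ; module PermutationReasoning)
open import Data.List.Relation.Binary.Permutation.Propositional.Properties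
  using (↭-length; shift; ++⁺ˡ; filter-↭)
open import Data.List.Relation.Binary.Permutation.Setoid.Properties using (foldr-commMonoid)
open import Data.List.Relation.Binary.Subset.Propositional using (_⊆_)
open import Data.List.Relation.Unary.All as All using (All)
open import Data.List.Relation.Unary.AllPairs using ([]; _∷_)
open import Data.List.Relation.Unary.Any using (here; there; any?; satisfied)
open import Data.List.Relation.Unary.Unique.Propositional using (Unique)
import Data.List.Relation.Unary.Unique.Propositional.Properties as Unique
open import Data.Nat using (ℕ; zero; suc; _≤_; s≤s; _%_; _/_)
  renaming (_^_ to _^ℕ_; _+_ to _+ℕ_; _*_ to _*ℕ_)
open import Data.Nat.DivMod using (m≡m%n+[m/n]*n)
open import Data.Nat.Primality using (Prime)
import Data.Nat.Properties as ℕ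
open import Data.Nat.Tactic.RingSolver using (solve-∀)
open import Data.Product using (_×_; _,_; proj₁; proj₂; ∃-syntax)
open import Data.Sum using (_⊎_; inj₁; inj₂; [_,_]′)
open import Function.Base using (_∘_; case_of_)
open import Function.Bundles using (mk⇔)
open import Relation.Binary.Definitions using (DecidableEquality)
open import Relation.Binary.PropositionalEquality
open import Relation.Binary.PropositionalEquality.Properties using (setoid)
open import Relation.Nullary using (¬_; Dec; yes; no; contradiction)
open import Relation.Nullary.Decidable using (¬?)
open import Relation.Unary using (Pred; Decidable)

open import Defs

module _ {a} {A : Set a} where

  Enumerates : List A → Set a
  Enumerates xs = Unique xs × (∀ x → x ∈ xs)

  unique-⊆-⊇⇒↭ : ∀ {xs ys : List A} → Unique xs → Unique ys → xs ⊆ ys → ys ⊆ xs → xs ↭ ys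
  unique-⊆-⊇⇒↭ xs! ys! xs⊆ys ys⊆xs = ∼bag⇒↭ (unique∧set⇒bag xs! ys! (mk⇔ xs⊆ys ys⊆xs))

  module _ {p q} {P : Pred A p} {Q : Pred A q} (P? : Decidable P) (Q? : Decidable Q) where

    length-filter-bijection : ∀ {xs} → Enumerates xs → (f g : A → A) →
      (∀ x → g (f x) ≡ x) → (∀ y → f (g y) ≡ y) →
      (∀ x → P x → Q (f x)) → (∀ x → Q (f x) → P x) →
      length (filter P? xs) ≡ length (filter Q? xs)
    length-filter-bijection {xs} (xs! , xs-complete) f g g∘f f∘g P⇒Qf Qf⇒P = begin
      length (filter P? xs)          ≡⟨ length-map f (filter P? xs) ⟨
      length (map f (filter P? xs))  ≡⟨ ↭-length image↭ ⟩
      length (filter Q? xs)          ∎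
      where
      open ≡-Reasoning
      f-injective : ∀ {x y} → f x ≡ f y → x ≡ y
      f-injective {x} {y} fx≡fy = trans (sym (g∘f x)) (trans (cong g fx≡fy) (g∘f y))
      image⊆ : map f (filter P? xs) ⊆ filter Q? xs
      image⊆ z∈ with ∈-map⁻ f z∈
      ... | x , x∈ , refl = ∈-filter⁺ Q? (xs-complete (f x)) (P⇒Qf x (proj₂ (∈-filter⁻ P? {xs = xs} x∈)))
      image⊇ : filter Q? xs ⊆ map f (filter P? xs)
      image⊇ {y} y∈ = subst (_∈ map f (filter P? xs)) (f∘g y)
        (∈-map⁺ f (∈-filter⁺ P? (xs-complete (g y))
          (Qf⇒P (g y) (subst Q (sym (f∘g y)) (proj₂ (∈-filter⁻ Q? {xs = xs} y∈))))))
      image↭ : map f (filter P? xs) ↭ filter Q? xs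
      image↭ = unique-⊆-⊇⇒↭ (Unique.map⁺ f-injective (Unique.filter⁺ P? xs!)) (Unique.filter⁺ Q? xs!)
        image⊆ image⊇

module _ {a b} {A : Set a} {B : Set b} where

  enumerates-cartesianProduct : ∀ {xs : List A} {ys : List B} →
    Enumerates xs → Enumerates ys → Enumerates (cartesianProduct xs ys)
  enumerates-cartesianProduct (xs! , xs-complete) (ys! , ys-complete) =
    Unique.cartesianProduct⁺ xs! ys! , λ (x , y) → ∈-cartesianProduct⁺ (xs-complete x) (ys-complete y)

module _ {a} {A : Set a} (_≟_ : DecidableEquality A) where

  remove : A → List A → List A
  remove c = filter (λ z → ¬? (z ≟ c))

  ∈-remove⁻ : ∀ {c z xs} → z ∈ remove c xs → z ∈ xs × z ≢ c
  ∈-remove⁻ {xs = xs} = ∈-filter⁻ (λ z → ¬? (z ≟ _)) {xs = xs}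

  unique⇒↭-remove : ∀ {c xs} → Unique xs → c ∈ xs → xs ↭ c ∷ remove c xs
  unique⇒↭-remove {c} {xs} xs! c∈xs = unique-⊆-⊇⇒↭ xs! (c∉rest ∷ rest!) split merge
    where
    rest! : Unique (remove c xs)
    rest! = Unique.filter⁺ (λ z → ¬? (z ≟ c)) xs!
    c∉rest : All (c ≢_) (remove c xs)
    c∉rest = All.tabulate λ z∈ c≡z → proj₂ (∈-remove⁻ {xs = xs} z∈) (sym c≡z)
    split : xs ⊆ (c ∷ remove c xs)
    split {z} z∈ with z ≟ c
    ... | yes refl = here refl
    ... | no z≢c = there (∈-filter⁺ (λ z → ¬? (z ≟ c)) z∈ z≢c)
    merge : (c ∷ remove c xs) ⊆ xs
    merge (here refl) = c∈xs
    merge (there z∈) = proj₁ (∈-remove⁻ {xs = xs} z∈)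

module Involution {a} {A : Set a} (_≟_ : DecidableEquality A) (ι : A → A) where

  fixes : List A → List A
  fixes = filter (λ y → ι y ≟ y)

  orbits : List A → List A
  orbits = concatMap (λ y → y ∷ ι y ∷ [])

  length-orbits : ∀ ys → length (orbits ys) ≡ 2 *ℕ length ys
  length-orbits [] = refl
  length-orbits (y ∷ ys) = trans (cong (2 +ℕ_) (length-orbits ys)) (sym (ℕ.*-suc 2 (length ys)))

  record IsInvolutionOn (xs : List A) : Set a where
    field
      closed     : ∀ {y} → y ∈ xs → ι y ∈ xs
      involutive : ∀ {y} → y ∈ xs → ι (ι y) ≡ y

    ιy≡z⇒y≡ιz : ∀ {y z} → y ∈ xs → ι y ≡ z → y ≡ ι z
    ιy≡z⇒y≡ιz y∈ refl = sym (involutive y∈)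

  private
    drop-fixed : ∀ {y xs} → Unique (y ∷ xs) → IsInvolutionOn (y ∷ xs) → ι y ≡ y → IsInvolutionOn xs
    drop-fixed {y} {xs} (y∉xs ∷ _) inv ιy≡y = record
      { closed = closed′ ; involutive = λ z∈ → involutive (there z∈) }
      where
      open IsInvolutionOn inv
      closed′ : ∀ {z} → z ∈ xs → ι z ∈ xs
      closed′ z∈ with closed (there z∈)
      ... | there ιz∈ = ιz∈
      ... | here ιz≡y = contradiction (sym (trans (ιy≡z⇒y≡ιz (there z∈) ιz≡y) ιy≡y)) (All.lookup y∉xs z∈)

    drop-orbit : ∀ {y xs} → Unique (y ∷ xs) → IsInvolutionOn (y ∷ xs) → ι y ≢ y →
                 IsInvolutionOn (remove _≟_ (ι y) xs)
    drop-orbit {y} {xs} (y∉xs ∷ _) inv ιy≢y = record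
      { closed = closed′ ; involutive = λ z∈ → involutive (there (proj₁ (∈-remove⁻ _≟_ {xs = xs} z∈))) }
      where
      open IsInvolutionOn inv
      closed′ : ∀ {z} → z ∈ remove _≟_ (ι y) xs → ι z ∈ remove _≟_ (ι y) xs
      closed′ z∈ with ∈-remove⁻ _≟_ {xs = xs} z∈
      ... | z∈xs , z≢ιy with closed (there z∈xs)
      ...   | here ιz≡y = contradiction (ιy≡z⇒y≡ιz (there z∈xs) ιz≡y) z≢ιy
      ...   | there ιz∈ = ∈-filter⁺ (λ w → ¬? (w ≟ ι y)) ιz∈ λ ιz≡ιy →
                All.lookup y∉xs z∈xs (sym (trans (ιy≡z⇒y≡ιz (there z∈xs) ιz≡ιy) (involutive (here refl))))

  orbit-decomposition : ∀ {xs} → Unique xs → IsInvolutionOn xs →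
                        ∃[ ys ] ys ⊆ xs × xs ↭ orbits ys ++ fixes xs
  orbit-decomposition {xs} = go (length xs) ℕ.≤-refl
    where
    go : ∀ n {xs} → length xs ≤ n → Unique xs → IsInvolutionOn xs →
         ∃[ ys ] ys ⊆ xs × xs ↭ orbits ys ++ fixes xs
    go _ {[]} _ _ _ = [] , (λ ()) , ↭-refl
    go (suc n) {y ∷ xs} (s≤s len) y∷xs!@(_ ∷ xs!) inv with ι y ≟ y
    ... | yes ιy≡y with go n len xs! (drop-fixed y∷xs! inv ιy≡y)
    -- Abstracting ι y ≟ y has already reduced fixes (y ∷ xs) in the goal, here and below.
    ...   | ys , ys⊆ , xs↭ = ys , there ∘ ys⊆ , (begin
            y ∷ xs                        ↭⟨ prep y xs↭ ⟩
            y ∷ orbits ys ++ fixes xs     ↭⟨ shift y (orbits ys) (fixes xs) ⟨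
            orbits ys ++ y ∷ fixes xs     ∎)
      where open PermutationReasoning
    go (suc n) {y ∷ xs} (s≤s len) y∷xs!@(_ ∷ xs!) inv | no ιy≢y
      with go n (ℕ.≤-trans (length-filter _ xs) len) (Unique.filter⁺ _ xs!) (drop-orbit y∷xs! inv ιy≢y)
    ...   | ys , ys⊆ , rest↭ = y ∷ ys , y∷ys⊆ , (begin
            y ∷ xs                                ↭⟨ prep y (unique⇒↭-remove _≟_ xs! ιy∈xs) ⟩
            y ∷ ι y ∷ rest                        ↭⟨ prep y (prep (ι y) rest↭) ⟩
            orbits (y ∷ ys) ++ fixes rest         ↭⟨ ++⁺ˡ (orbits (y ∷ ys)) fixes-rest↭ ⟩
            orbits (y ∷ ys) ++ fixes xs           ∎)
      where
      open PermutationReasoning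
      open IsInvolutionOn inv
      rest : List A
      rest = remove _≟_ (ι y) xs
      ιy∈xs : ι y ∈ xs
      ιy∈xs with closed (here refl)
      ... | here ιy≡y = contradiction ιy≡y ιy≢y
      ... | there ιy∈ = ιy∈
      y∷ys⊆ : (y ∷ ys) ⊆ (y ∷ xs)
      y∷ys⊆ (here refl) = here refl
      y∷ys⊆ (there z∈) = there (proj₁ (∈-remove⁻ _≟_ {xs = xs} (ys⊆ z∈)))
      fixes-rest↭ : fixes rest ↭ fixes xs
      fixes-rest↭ = begin
        fixes rest             ≡⟨ filter-reject (λ z → ι z ≟ z) (λ ιιy≡ιy → ιy≢y (trans (sym ιιy≡ιy) (involutive (here refl)))) ⟨
        fixes (ι y ∷ rest)     ↭⟨ filter-↭ (λ z → ι z ≟ z) (unique⇒↭-remove _≟_ xs! ιy∈xs) ⟨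
        fixes xs               ∎

module _ (K : FiniteField) where

  open FiniteField K

  commutativeRing : CommutativeRing _ _
  commutativeRing = record { isCommutativeRing = isCommutativeRing }

  open CommutativeRing commutativeRing
    using ( +-assoc; +-comm; +-identityˡ; +-identityʳ; -‿inverseˡ; -‿inverseʳ
          ; *-assoc; *-comm; *-identityˡ; *-identityʳ; distribˡ; distribʳ; zeroˡ; zeroʳ
          ; *-isCommutativeMonoid; ring)
  open AbelianGroupProperties (CommutativeRing.+-abelianGroup commutativeRing)
    using (⁻¹-anti-homo‿-) renaming (∙-cancelˡ to +-cancelˡ; ⁻¹-injective to -‿injective; ⁻¹-∙-comm to -‿+-comm)
  open RingProperties ring
    using (-‿involutive; -‿distribˡ-*; -‿distribʳ-*; -0#≈0#; -1*x≈-x; x∙y⁻¹≈ε⇒x≈y; +-inverseˡ-unique)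
  open CommutativeMonoidSolver (CommutativeRing.*-commutativeMonoid commutativeRing) using (solve; _⊜_; _⊕_)

  ⁻¹-inverseˡ : ∀ {x} → x ≢ 0# → x ⁻¹ * x ≡ 1#
  ⁻¹-inverseˡ {x} x≢0 = trans (*-comm (x ⁻¹) x) (⁻¹-inverse x x≢0)

  *-cancelˡ-≢0 : ∀ {x y z} → x ≢ 0# → x * y ≡ x * z → y ≡ z
  *-cancelˡ-≢0 {x} {y} {z} x≢0 xy≡xz = begin
    y                ≡⟨ *-identityˡ y ⟨
    1# * y           ≡⟨ cong (_* y) (⁻¹-inverseˡ x≢0) ⟨
    (x ⁻¹ * x) * y   ≡⟨ *-assoc (x ⁻¹) x y ⟩
    x ⁻¹ * (x * y)   ≡⟨ cong (x ⁻¹ *_) xy≡xz ⟩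
    x ⁻¹ * (x * z)   ≡⟨ *-assoc (x ⁻¹) x z ⟨
    (x ⁻¹ * x) * z   ≡⟨ cong (_* z) (⁻¹-inverseˡ x≢0) ⟩
    1# * z           ≡⟨ *-identityˡ z ⟩
    z                ∎
    where open ≡-Reasoning

  *-cancelʳ-≢0 : ∀ {x y z} → z ≢ 0# → x * z ≡ y * z → x ≡ y
  *-cancelʳ-≢0 {x} {y} {z} z≢0 xz≡yz = *-cancelˡ-≢0 z≢0 (trans (*-comm z x) (trans xz≡yz (*-comm y z)))

  x*y≡0⇒x≡0⊎y≡0 : ∀ {x y} → x * y ≡ 0# → x ≡ 0# ⊎ y ≡ 0#
  x*y≡0⇒x≡0⊎y≡0 {x} {y} xy≡0 with x ≟ 0#
  ... | yes x≡0 = inj₁ x≡0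
  ... | no x≢0 = inj₂ (*-cancelˡ-≢0 x≢0 (trans xy≡0 (sym (zeroʳ x))))

  *-≢0 : ∀ {x y} → x ≢ 0# → y ≢ 0# → x * y ≢ 0#
  *-≢0 x≢0 y≢0 xy≡0 = [ x≢0 , y≢0 ]′ (x*y≡0⇒x≡0⊎y≡0 xy≡0)

  ⁻¹-≢0 : ∀ {x} → x ≢ 0# → x ⁻¹ ≢ 0#
  ⁻¹-≢0 {x} x≢0 x⁻¹≡0 = 0≢1 (begin
    0#           ≡⟨ zeroʳ x ⟨
    x * 0#       ≡⟨ cong (x *_) x⁻¹≡0 ⟨
    x * x ⁻¹     ≡⟨ ⁻¹-inverse x x≢0 ⟩
    1#           ∎)
    where open ≡-Reasoning

  -‿≢0 : ∀ {x} → x ≢ 0# → - x ≢ 0#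
  -‿≢0 {x} x≢0 -x≡0 = x≢0 (trans (sym (-‿involutive x)) (trans (cong -_ -x≡0) -0#≈0#))

  ^-≢0 : ∀ {x} r → x ≢ 0# → x ^ r ≢ 0#
  ^-≢0 zero x≢0 = 0≢1 ∘ sym
  ^-≢0 (suc r) x≢0 = *-≢0 x≢0 (^-≢0 r x≢0)

  *⁻¹-cancelʳ : ∀ {d} → d ≢ 0# → ∀ b → b * d * d ⁻¹ ≡ b
  *⁻¹-cancelʳ {d} d≢0 b = trans (*-assoc b d (d ⁻¹)) (trans (cong (b *_) (⁻¹-inverse d d≢0)) (*-identityʳ b))

  ⁻¹*-cancelʳ : ∀ {d} → d ≢ 0# → ∀ b → b * d ⁻¹ * d ≡ b
  ⁻¹*-cancelʳ {d} d≢0 b = trans (*-assoc b (d ⁻¹) d) (trans (cong (b *_) (⁻¹-inverseˡ d≢0)) (*-identityʳ b))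

  *≡⇒≡*⁻¹ : ∀ {d z b} → d ≢ 0# → d * z ≡ b → z ≡ b * d ⁻¹
  *≡⇒≡*⁻¹ {d} {z} d≢0 refl = sym (trans (cong (_* d ⁻¹) (*-comm d z)) (*⁻¹-cancelʳ d≢0 z))

  ≡*⁻¹⇒*≡ : ∀ {d z b} → d ≢ 0# → z ≡ b * d ⁻¹ → d * z ≡ b
  ≡*⁻¹⇒*≡ {d} {b = b} d≢0 refl = trans (*-comm d (b * d ⁻¹)) (⁻¹*-cancelʳ d≢0 b)

  [x-y][x+y]≡x²-y² : ∀ x y → (x - y) * (x + y) ≡ x * x - y * y
  [x-y][x+y]≡x²-y² x y = begin
    (x - y) * (x + y)                          ≡⟨ distribʳ (x + y) x (- y) ⟩
    x * (x + y) + - y * (x + y)                ≡⟨ cong₂ _+_ (distribˡ x x y) (distribˡ (- y) x y) ⟩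
    (x * x + x * y) + (- y * x + - y * y)      ≡⟨ cong₂ (λ p q → (x * x + x * y) + (p + q)) -yx≡-xy (-‿distribˡ-* y y) ⟨
    (x * x + x * y) + (- (x * y) + - (y * y))  ≡⟨ +-assoc (x * x) (x * y) _ ⟩
    x * x + (x * y + (- (x * y) + - (y * y)))  ≡⟨ cong (x * x +_) (+-assoc (x * y) (- (x * y)) _) ⟨
    x * x + ((x * y - x * y) + - (y * y))      ≡⟨ cong (λ p → x * x + (p + - (y * y))) (-‿inverseʳ (x * y)) ⟩
    x * x + (0# + - (y * y))                   ≡⟨ cong (x * x +_) (+-identityˡ _) ⟩
    x * x - y * y                              ∎
    where
    open ≡-Reasoning
    -yx≡-xy : - (x * y) ≡ - y * x
    -yx≡-xy = trans (cong -_ (*-comm x y)) (-‿distribˡ-* y x)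

  -x*-y≡x*y : ∀ x y → - x * - y ≡ x * y
  -x*-y≡x*y x y = trans (sym (-‿distribˡ-* x (- y))) (trans (cong -_ (sym (-‿distribʳ-* x y))) (-‿involutive (x * y)))

  square-roots : ∀ {x y} → x * x ≡ y * y → x ≡ y ⊎ x ≡ - y
  square-roots {x} {y} x²≡y² with x*y≡0⇒x≡0⊎y≡0 x-y*x+y≡0
    where
    x-y*x+y≡0 : (x - y) * (x + y) ≡ 0#
    x-y*x+y≡0 = trans ([x-y][x+y]≡x²-y² x y) (trans (cong (_- y * y) x²≡y²) (-‿inverseʳ (y * y)))
  ... | inj₁ x-y≡0 = inj₁ (x∙y⁻¹≈ε⇒x≈y x y x-y≡0)
  ... | inj₂ x+y≡0 = inj₂ (+-inverseˡ-unique x y x+y≡0)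

  x≢-x : 1# + 1# ≢ 0# → ∀ {x} → x ≢ 0# → x ≢ - x
  x≢-x 2≢0 {x} x≢0 x≡-x = [ 2≢0 , x≢0 ]′ (x*y≡0⇒x≡0⊎y≡0 (begin
    (1# + 1#) * x   ≡⟨ distribʳ x 1# 1# ⟩
    1# * x + 1# * x ≡⟨ cong₂ _+_ (*-identityˡ x) (*-identityˡ x) ⟩
    x + x           ≡⟨ cong (x +_) x≡-x ⟩
    x - x           ≡⟨ -‿inverseʳ x ⟩
    0#              ∎))
    where open ≡-Reasoning

  ^-distribˡ-* : ∀ x y r → (x * y) ^ r ≡ x ^ r * y ^ r
  ^-distribˡ-* x y zero = sym (*-identityˡ 1#)
  ^-distribˡ-* x y (suc r) = trans (cong (x * y *_) (^-distribˡ-* x y r))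
    (solve 4 (λ x y p q → (x ⊕ y) ⊕ (p ⊕ q) ⊜ (x ⊕ p) ⊕ (y ⊕ q)) refl x y (x ^ r) (y ^ r))

  ^-+ : ∀ x m n → x ^ (m +ℕ n) ≡ x ^ m * x ^ n
  ^-+ x zero n = sym (*-identityˡ (x ^ n))
  ^-+ x (suc m) n = trans (cong (x *_) (^-+ x m n)) (sym (*-assoc x (x ^ m) (x ^ n)))

  [-x]^r≡[-1]^r*x^r : ∀ x r → (- x) ^ r ≡ (- 1#) ^ r * x ^ r
  [-x]^r≡[-1]^r*x^r x r = trans (cong (_^ r) (sym (-1*x≈-x x))) (^-distribˡ-* (- 1#) x r)

  [-1]^r*[-1]^r≡1 : ∀ r → (- 1#) ^ r * (- 1#) ^ r ≡ 1#
  [-1]^r*[-1]^r≡1 r = begin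
    (- 1#) ^ r * (- 1#) ^ r    ≡⟨ ^-distribˡ-* (- 1#) (- 1#) r ⟨
    (- 1# * - 1#) ^ r          ≡⟨ cong (_^ r) (trans (-1*x≈-x (- 1#)) (-‿involutive 1#)) ⟩
    1# ^ r                     ≡⟨ 1^r≡1 r ⟩
    1#                         ∎
    where
    open ≡-Reasoning
    1^r≡1 : ∀ r → 1# ^ r ≡ 1#
    1^r≡1 zero = refl
    1^r≡1 (suc r) = trans (*-identityˡ (1# ^ r)) (1^r≡1 r)

  [-1]^[1+2j]≡-1 : ∀ j → (- 1#) ^ suc (2 *ℕ j) ≡ - 1#
  [-1]^[1+2j]≡-1 j = begin
    - 1# * (- 1#) ^ (j +ℕ (j +ℕ 0))    ≡⟨ cong (λ n → - 1# * (- 1#) ^ (j +ℕ n)) (ℕ.+-identityʳ j) ⟩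
    - 1# * (- 1#) ^ (j +ℕ j)           ≡⟨ cong (- 1# *_) (^-+ (- 1#) j j) ⟩
    - 1# * ((- 1#) ^ j * (- 1#) ^ j)   ≡⟨ cong (- 1# *_) ([-1]^r*[-1]^r≡1 j) ⟩
    - 1# * 1#                          ≡⟨ *-identityʳ (- 1#) ⟩
    - 1#                               ∎
    where open ≡-Reasoning

  prod : List Carrier → Carrier
  prod = foldr _*_ 1#

  prod-↭ : ∀ {xs ys} → xs ↭ ys → prod xs ≡ prod ys
  prod-↭ xs↭ys = foldr-commMonoid (setoid Carrier) *-isCommutativeMonoid (↭⇒↭ₛ xs↭ys)

  prod-++ : ∀ xs ys → prod (xs ++ ys) ≡ prod xs * prod ys
  prod-++ [] ys = sym (*-identityˡ (prod ys))
  prod-++ (x ∷ xs) ys = trans (cong (x *_) (prod-++ xs ys)) (sym (*-assoc x (prod xs) (prod ys)))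

  module _ {ι : Carrier → Carrier} where

    open Involution _≟_ ι

    prod-orbits : ∀ {c} ys → (∀ {y} → y ∈ ys → y * ι y ≡ c) → prod (orbits ys) ≡ c ^ length ys
    prod-orbits [] _ = refl
    prod-orbits {c} (y ∷ ys) y*ιy≡c = begin
      y * (ι y * prod (orbits ys))  ≡⟨ *-assoc y (ι y) _ ⟨
      (y * ι y) * prod (orbits ys)  ≡⟨ cong₂ _*_ (y*ιy≡c (here refl)) (prod-orbits ys (y*ιy≡c ∘ there)) ⟩
      c * c ^ length ys             ∎
      where open ≡-Reasoning

    prod-involution : ∀ {c xs} → Unique xs → IsInvolutionOn xs → (∀ {y} → y ∈ xs → y * ι y ≡ c) →
      ∃[ k ] length xs ≡ 2 *ℕ k +ℕ length (fixes xs) × prod xs ≡ c ^ k * prod (fixes xs)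
    prod-involution {c} {xs} xs! inv y*ιy≡c with orbit-decomposition xs! inv
    ... | ys , ys⊆xs , xs↭ = length ys , length-xs , prod-xs
      where
      open ≡-Reasoning
      length-xs : length xs ≡ 2 *ℕ length ys +ℕ length (fixes xs)
      length-xs = begin
        length xs                                  ≡⟨ ↭-length xs↭ ⟩
        length (orbits ys ++ fixes xs)             ≡⟨ length-++ (orbits ys) ⟩
        length (orbits ys) +ℕ length (fixes xs)    ≡⟨ cong (_+ℕ length (fixes xs)) (length-orbits ys) ⟩
        2 *ℕ length ys +ℕ length (fixes xs)        ∎
      prod-xs : prod xs ≡ c ^ length ys * prod (fixes xs)
      prod-xs = begin
        prod xs                                    ≡⟨ prod-↭ xs↭ ⟩
        prod (orbits ys ++ fixes xs)               ≡⟨ prod-++ (orbits ys) (fixes xs) ⟩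
        prod (orbits ys) * prod (fixes xs)         ≡⟨ cong (_* prod (fixes xs)) (prod-orbits ys (y*ιy≡c ∘ ys⊆xs)) ⟩
        c ^ length ys * prod (fixes xs)            ∎

  IsSquare : Carrier → Set
  IsSquare x = ∃[ y ] y * y ≡ x

  isSquare? : ∀ x → Dec (IsSquare x)
  isSquare? x with any? (λ y → (y * y) ≟ x) elements
  ... | yes root = yes (satisfied root)
  ... | no no-root = no λ (y , y²≡x) → no-root (lose (complete y) y²≡x)

  η-0 : η 0# ≡ 0#
  η-0 with 0# ≟ 0#
  ... | yes _ = refl
  ... | no 0≢0 = contradiction refl 0≢0

  η-square : ∀ {x} → x ≢ 0# → IsSquare x → η x ≡ 1#
  η-square {x} x≢0 (y , y²≡x) with x ≟ 0#
  ... | yes x≡0 = contradiction x≡0 x≢0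
  ... | no _ with any? (λ z → (z * z) ≟ x) elements
  ...   | yes _ = refl
  ...   | no no-root = contradiction (lose (complete y) y²≡x) no-root

  η-nonsquare : ∀ {x} → x ≢ 0# → ¬ IsSquare x → η x ≡ - 1#
  η-nonsquare {x} x≢0 nonsquare with x ≟ 0#
  ... | yes x≡0 = contradiction x≡0 x≢0
  ... | no _ with any? (λ z → (z * z) ≟ x) elements
  ...   | yes root = contradiction (satisfied root) nonsquare
  ...   | no _ = refl

  module OddOrder {h : ℕ} (order≡1+2h : order ≡ suc (2 *ℕ h)) where

    1+1≢0 : 1# + 1# ≢ 0#
    1+1≢0 2≡0 = ℕ.even≢odd (length ys) h (begin
      2 *ℕ length ys                    ≡⟨ length-orbits ys ⟨
      length (orbits ys)                ≡⟨ cong length (++-identityʳ (orbits ys)) ⟨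
      length (orbits ys ++ [])          ≡⟨ cong (λ zs → length (orbits ys ++ zs)) no-fixed-points ⟨
      length (orbits ys ++ fixes elements) ≡⟨ ↭-length elements↭ ⟨
      order                             ≡⟨ order≡1+2h ⟩
      suc (2 *ℕ h)                      ∎)
      where
      open ≡-Reasoning
      open Involution _≟_ (_+ 1#)
      translation-involution : IsInvolutionOn elements
      translation-involution = record
        { closed = λ {y} _ → complete (y + 1#)
        ; involutive = λ {y} _ → trans (+-assoc y 1# 1#) (trans (cong (y +_) 2≡0) (+-identityʳ y)) }
      no-fixed-points : fixes elements ≡ []
      no-fixed-points = filter-none (λ y → (y + 1#) ≟ y) {xs = elements} (All.tabulate λ {y} _ y+1≡y →
        0≢1 (sym (+-cancelˡ y 1# 0# (trans y+1≡y (sym (+-identityʳ y))))))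
      decomposition : ∃[ ys ] ys ⊆ elements × elements ↭ orbits ys ++ fixes elements
      decomposition = orbit-decomposition unique translation-involution
      ys : List Carrier
      ys = proj₁ decomposition
      elements↭ : elements ↭ orbits ys ++ fixes elements
      elements↭ = proj₂ (proj₂ decomposition)

    nonzero : List Carrier
    nonzero = remove _≟_ 0# elements

    ∈-nonzero : ∀ {y} → y ≢ 0# → y ∈ nonzero
    ∈-nonzero {y} = ∈-filter⁺ (λ z → ¬? (z ≟ 0#)) (complete y)

    ∈-nonzero⁻ : ∀ {y} → y ∈ nonzero → y ≢ 0#
    ∈-nonzero⁻ y∈ = proj₂ (∈-remove⁻ _≟_ {xs = elements} y∈)

    nonzero! : Unique nonzero
    nonzero! = Unique.filter⁺ (λ z → ¬? (z ≟ 0#)) unique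

    length-nonzero : length nonzero ≡ 2 *ℕ h
    length-nonzero = ℕ.suc-injective
      (trans (sym (↭-length (unique⇒↭-remove _≟_ unique (complete 0#)))) order≡1+2h)

    module _ {x} (x≢0 : x ≢ 0#) where

      private
        ι : Carrier → Carrier
        ι y = x * y ⁻¹

        open Involution _≟_ ι

        y*ιy≡x : ∀ {y} → y ≢ 0# → y * ι y ≡ x
        y*ιy≡x {y} y≢0 = trans (solve 3 (λ y x z → y ⊕ (x ⊕ z) ⊜ x ⊕ (y ⊕ z)) refl y x (y ⁻¹))
                               (trans (cong (x *_) (⁻¹-inverse y y≢0)) (*-identityʳ x))

        ιy≢0 : ∀ {y} → y ≢ 0# → ι y ≢ 0#
        ιy≢0 y≢0 = *-≢0 x≢0 (⁻¹-≢0 y≢0)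

        division-involution : IsInvolutionOn nonzero
        division-involution = record
          { closed = λ y∈ → ∈-nonzero (ιy≢0 (∈-nonzero⁻ y∈))
          ; involutive = λ {y} y∈ → let y≢0 = ∈-nonzero⁻ y∈ in
              trans (cong (_* ι y ⁻¹) (sym (y*ιy≡x y≢0))) (*⁻¹-cancelʳ (ιy≢0 y≢0) y) }

        fixed⇒square : ∀ {y} → y ≢ 0# → ι y ≡ y → y * y ≡ x
        fixed⇒square {y} y≢0 ιy≡y = trans (cong (y *_) (sym ιy≡y)) (y*ιy≡x y≢0)

        square⇒fixed : ∀ {y} → y ≢ 0# → y * y ≡ x → ι y ≡ y
        square⇒fixed y≢0 y²≡x = *-cancelˡ-≢0 y≢0 (trans (y*ιy≡x y≢0) (sym y²≡x))

        fixes-nonzero↭±t : ∀ {t} → t * t ≡ x → fixes nonzero ↭ t ∷ - t ∷ []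
        fixes-nonzero↭±t {t} t²≡x = unique-⊆-⊇⇒↭ (Unique.filter⁺ (λ y → ι y ≟ y) nonzero!)
          ((All.tabulate λ { (here refl) → x≢-x 1+1≢0 t≢0 }) ∷ (All.[] ∷ []))
          fixed⇒±t ±t⇒fixed
          where
          t≢0 : t ≢ 0#
          t≢0 t≡0 = x≢0 (trans (sym t²≡x) (trans (cong (_* t) t≡0) (zeroˡ t)))
          fixed⇒±t : fixes nonzero ⊆ (t ∷ - t ∷ [])
          fixed⇒±t y∈ with ∈-filter⁻ (λ y → ι y ≟ y) {xs = nonzero} y∈
          ... | y∈nonzero , ιy≡y with square-roots (trans (fixed⇒square (∈-nonzero⁻ y∈nonzero) ιy≡y) (sym t²≡x))
          ...   | inj₁ refl = here refl
          ...   | inj₂ refl = there (here refl)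
          ±t⇒fixed : (t ∷ - t ∷ []) ⊆ fixes nonzero
          ±t⇒fixed (here refl) = ∈-filter⁺ (λ y → ι y ≟ y) (∈-nonzero t≢0) (square⇒fixed t≢0 t²≡x)
          ±t⇒fixed (there (here refl)) = ∈-filter⁺ (λ y → ι y ≟ y) (∈-nonzero (-‿≢0 t≢0))
            (square⇒fixed (-‿≢0 t≢0) (trans (-x*-y≡x*y t t) t²≡x))

        decomposition : ∃[ k ] length nonzero ≡ 2 *ℕ k +ℕ length (fixes nonzero)
                              × prod nonzero ≡ x ^ k * prod (fixes nonzero)
        decomposition = prod-involution nonzero! division-involution (y*ιy≡x ∘ ∈-nonzero⁻)
        k : ℕ
        k = proj₁ decomposition
        length-nonzero≡ : length nonzero ≡ 2 *ℕ k +ℕ length (fixes nonzero)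
        length-nonzero≡ = proj₁ (proj₂ decomposition)
        prod-nonzero≡ : prod nonzero ≡ x ^ k * prod (fixes nonzero)
        prod-nonzero≡ = proj₂ (proj₂ decomposition)

      prod-nonzero-nonsquare : ¬ IsSquare x → prod nonzero ≡ x ^ h
      prod-nonzero-nonsquare nonsquare = begin
        prod nonzero                   ≡⟨ prod-nonzero≡ ⟩
        x ^ k * prod (fixes nonzero)   ≡⟨ cong (λ zs → x ^ k * prod zs) no-fixed-points ⟩
        x ^ k * 1#                     ≡⟨ *-identityʳ (x ^ k) ⟩
        x ^ k                          ≡⟨ cong (x ^_) k≡h ⟩
        x ^ h                          ∎
        where
        open ≡-Reasoning
        no-fixed-points : fixes nonzero ≡ []
        no-fixed-points = filter-none (λ y → ι y ≟ y) {xs = nonzero}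
          (All.tabulate λ {y} y∈ ιy≡y → nonsquare (y , fixed⇒square (∈-nonzero⁻ y∈) ιy≡y))
        k≡h : k ≡ h
        k≡h = ℕ.*-cancelˡ-≡ k h 2 (begin
          2 *ℕ k                                 ≡⟨ ℕ.+-identityʳ (2 *ℕ k) ⟨
          2 *ℕ k +ℕ length ([] {A = Carrier})    ≡⟨ cong (λ zs → 2 *ℕ k +ℕ length zs) no-fixed-points ⟨
          2 *ℕ k +ℕ length (fixes nonzero)       ≡⟨ length-nonzero≡ ⟨
          length nonzero                         ≡⟨ length-nonzero ⟩
          2 *ℕ h                                 ∎)

      prod-nonzero-square : IsSquare x → prod nonzero ≡ - (x ^ h)
      prod-nonzero-square (t , t²≡x) = begin
        prod nonzero                       ≡⟨ prod-nonzero≡ ⟩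
        x ^ k * prod (fixes nonzero)       ≡⟨ cong (x ^ k *_) (prod-↭ (fixes-nonzero↭±t t²≡x)) ⟩
        x ^ k * (t * (- t * 1#))           ≡⟨ cong (λ z → x ^ k * (t * z)) (*-identityʳ (- t)) ⟩
        x ^ k * (t * - t)                  ≡⟨ cong (x ^ k *_) (-‿distribʳ-* t t) ⟨
        x ^ k * - (t * t)                  ≡⟨ cong (λ z → x ^ k * - z) t²≡x ⟩
        x ^ k * - x                        ≡⟨ -‿distribʳ-* (x ^ k) x ⟨
        - (x ^ k * x)                      ≡⟨ cong -_ (*-comm (x ^ k) x) ⟩
        - (x ^ suc k)                      ≡⟨ cong (λ n → - (x ^ n)) 1+k≡h ⟩
        - (x ^ h)                          ∎
        where
        open ≡-Reasoning
        1+k≡h : suc k ≡ h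
        1+k≡h = ℕ.*-cancelˡ-≡ (suc k) h 2 (begin
          2 *ℕ suc k                             ≡⟨ ℕ.*-suc 2 k ⟩
          2 +ℕ 2 *ℕ k                            ≡⟨ ℕ.+-comm 2 (2 *ℕ k) ⟩
          2 *ℕ k +ℕ length (t ∷ - t ∷ [])        ≡⟨ cong (2 *ℕ k +ℕ_) (↭-length (fixes-nonzero↭±t t²≡x)) ⟨
          2 *ℕ k +ℕ length (fixes nonzero)       ≡⟨ length-nonzero≡ ⟨
          length nonzero                         ≡⟨ length-nonzero ⟩
          2 *ℕ h                                 ∎)

      prod-nonzero : prod nonzero ≡ - (η x * x ^ h)
      prod-nonzero with isSquare? x
      ... | yes square = trans (prod-nonzero-square square)
            (cong -_ (sym (trans (cong (_* x ^ h) (η-square x≢0 square)) (*-identityˡ (x ^ h)))))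
      ... | no nonsquare = trans (prod-nonzero-nonsquare nonsquare)
            (sym (trans (cong -_ (trans (cong (_* x ^ h) (η-nonsquare x≢0 nonsquare)) (-1*x≈-x (x ^ h))))
                        (-‿involutive (x ^ h))))

    η-odd : (- 1#) ^ h ≡ - 1# → ∀ x → η (- x) ≡ - η x
    -- A case split by with on x ≟ 0# would also abstract it inside the definition of η.
    η-odd [-1]^h≡-1 x = case x ≟ 0# of λ where
        (yes refl) → begin
          η (- 0#)   ≡⟨ cong η -0#≈0# ⟩
          η 0#       ≡⟨ η-0 ⟩
          0#         ≡⟨ -0#≈0# ⟨
          - 0#       ≡⟨ cong -_ η-0 ⟨
          - η 0#     ∎
        (no x≢0) → trans (sym (-‿involutive (η (- x)))) (cong -_ (*-cancelʳ-≢0 (^-≢0 h x≢0) (begin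
          - η (- x) * x ^ h        ≡⟨ -‿distribˡ-* (η (- x)) (x ^ h) ⟨
          - (η (- x) * x ^ h)      ≡⟨ -‿distribʳ-* (η (- x)) (x ^ h) ⟩
          η (- x) * - (x ^ h)      ≡⟨ cong (η (- x) *_) [-x]^h≡-x^h ⟨
          η (- x) * (- x) ^ h      ≡⟨ -‿injective (trans (sym (prod-nonzero (-‿≢0 x≢0))) (prod-nonzero x≢0)) ⟩
          η x * x ^ h              ∎)))
      where
      open ≡-Reasoning
      [-x]^h≡-x^h : (- x) ^ h ≡ - (x ^ h)
      [-x]^h≡-x^h = trans ([-x]^r≡[-1]^r*x^r x h) (trans (cong (_* x ^ h) [-1]^h≡-1) (-1*x≈-x (x ^ h)))

  module Reflection (G H : Carrier → Carrier) {s} (s≢0 : s ≢ 0#) (G≡s*H[-x] : ∀ x → G x ≡ s * H (- x)) where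

    private
      -s≢0 : - s ≢ 0#
      -s≢0 = -‿≢0 s≢0

      reflect : Carrier → Carrier → Carrier
      reflect a x = - (x + a)

      reflect-+ : ∀ a x → reflect a x + a ≡ - x
      reflect-+ a x = begin
        - (x + a) + a        ≡⟨ cong (_+ a) (-‿+-comm x a) ⟨
        (- x + - a) + a      ≡⟨ +-assoc (- x) (- a) a ⟩
        - x + (- a + a)      ≡⟨ cong (- x +_) (-‿inverseˡ a) ⟩
        - x + 0#             ≡⟨ +-identityʳ (- x) ⟩
        - x                  ∎
        where open ≡-Reasoning

      reflect-involutive : ∀ a x → reflect a (reflect a x) ≡ x
      reflect-involutive a x = trans (cong -_ (reflect-+ a x)) (-‿involutive x)

      s*y-s*z≡s*[y-z] : ∀ y z → s * y - s * z ≡ s * (y - z)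
      s*y-s*z≡s*[y-z] y z = trans (cong (s * y +_) (-‿distribʳ-* s z)) (sym (distribˡ s y (- z)))

      s*y-s*z≡-s*[z-y] : ∀ y z → s * y - s * z ≡ - s * (z - y)
      s*y-s*z≡-s*[z-y] y z = begin
        s * y - s * z        ≡⟨ s*y-s*z≡s*[y-z] y z ⟩
        s * (y - z)          ≡⟨ cong (s *_) (⁻¹-anti-homo‿- z y) ⟨
        s * - (z - y)        ≡⟨ -‿distribʳ-* s (z - y) ⟨
        - (s * (z - y))      ≡⟨ -‿distribˡ-* s (z - y) ⟩
        - s * (z - y)        ∎
        where open ≡-Reasoning

      enumerates² : Enumerates (cartesianProduct elements elements)
      enumerates² = enumerates-cartesianProduct (unique , complete) (unique , complete)

      scale : Carrier → Carrier × Carrier → Carrier × Carrier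
      scale c (a , b) = a , b * c

      scale-inverseˡ : ∀ {c} → c ≢ 0# → ∀ p → scale c (scale (c ⁻¹) p) ≡ p
      scale-inverseˡ c≢0 (a , b) = cong (a ,_) (⁻¹*-cancelʳ c≢0 b)

      scale-inverseʳ : ∀ {c} → c ≢ 0# → ∀ p → scale (c ⁻¹) (scale c p) ≡ p
      scale-inverseʳ c≢0 (a , b) = cong (a ,_) (*⁻¹-cancelʳ c≢0 b)

    δ-reflection : ∀ a b → δ G a b ≡ δ H a (b * (- s) ⁻¹)
    δ-reflection a b = length-filter-bijection _ _ (unique , complete) (reflect a) (reflect a)
      (reflect-involutive a) (reflect-involutive a)
      (λ x Δ≡b → *≡⇒≡*⁻¹ -s≢0 (trans (sym (difference x)) Δ≡b))
      (λ x Δ≡b/-s → trans (difference x) (≡*⁻¹⇒*≡ -s≢0 Δ≡b/-s))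
      where
      difference : ∀ x → G (x + a) - G x ≡ - s * (H (reflect a x + a) - H (reflect a x))
      difference x = begin
        G (x + a) - G x                            ≡⟨ cong₂ _-_ (G≡s*H[-x] (x + a)) (G≡s*H[-x] x) ⟩
        s * H (reflect a x) - s * H (- x)          ≡⟨ cong (λ y → s * H (reflect a x) - s * H y) (reflect-+ a x) ⟨
        s * H (reflect a x) - s * H (reflect a x + a) ≡⟨ s*y-s*z≡-s*[z-y] _ _ ⟩
        - s * (H (reflect a x + a) - H (reflect a x)) ∎
        where open ≡-Reasoning

    β-reflection : ∀ a b → β G a b ≡ β H a (b * s ⁻¹)
    β-reflection a b = length-filter-bijection _ _ enumerates² reflect² reflect²
      reflect²-involutive reflect²-involutive
      (λ (x , y) (Δ₀≡b , Δ₁≡b) → *≡⇒≡*⁻¹ s≢0 (trans (sym (difference₁ x y)) Δ₁≡b)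
                               , *≡⇒≡*⁻¹ s≢0 (trans (sym (difference₀ x y)) Δ₀≡b))
      (λ (x , y) (Δ₁≡b/s , Δ₀≡b/s) → trans (difference₀ x y) (≡*⁻¹⇒*≡ s≢0 Δ₀≡b/s)
                                   , trans (difference₁ x y) (≡*⁻¹⇒*≡ s≢0 Δ₁≡b/s))
      where
      reflect² : Carrier × Carrier → Carrier × Carrier
      reflect² (x , y) = reflect a x , reflect a y
      reflect²-involutive : ∀ p → reflect² (reflect² p) ≡ p
      reflect²-involutive (x , y) = cong₂ _,_ (reflect-involutive a x) (reflect-involutive a y)
      difference₀ : ∀ x y → G x - G y ≡ s * (H (reflect a x + a) - H (reflect a y + a))
      difference₀ x y = trans (cong₂ _-_ (G≡s*H[-x] x) (G≡s*H[-x] y))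
        (trans (cong₂ (λ x′ y′ → s * H x′ - s * H y′) (sym (reflect-+ a x)) (sym (reflect-+ a y)))
               (s*y-s*z≡s*[y-z] _ _))
      difference₁ : ∀ x y → G (x + a) - G (y + a) ≡ s * (H (reflect a x) - H (reflect a y))
      difference₁ x y = trans (cong₂ _-_ (G≡s*H[-x] (x + a)) (G≡s*H[-x] (y + a))) (s*y-s*z≡s*[y-z] _ _)

    ω-reflection : ∀ i → ω G i ≡ ω H i
    ω-reflection i = length-filter-bijection _ _ enumerates² (scale ((- s) ⁻¹)) (scale (- s))
      (scale-inverseˡ -s≢0) (scale-inverseʳ -s≢0)
      (λ (a , b) (a≢0 , δ≡i) → a≢0 , trans (sym (δ-reflection a b)) δ≡i)
      (λ (a , b) (a≢0 , δ≡i) → a≢0 , trans (δ-reflection a b) δ≡i)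

    ν-reflection : ∀ i → ν G i ≡ ν H i
    ν-reflection i = length-filter-bijection _ _ enumerates² (scale (s ⁻¹)) (scale s)
      (scale-inverseˡ s≢0) (scale-inverseʳ s≢0)
      (λ (a , b) ((a≢0 , b≢0) , β≡i) → (a≢0 , *-≢0 b≢0 (⁻¹-≢0 s≢0)) , trans (sym (β-reflection a b)) β≡i)
      (λ (a , b) ((a≢0 , b/s≢0) , β≡i) → (a≢0 , λ b≡0 → b/s≢0 (trans (cong (_* s ⁻¹) b≡0) (zeroˡ (s ⁻¹))))
                                        , trans (β-reflection a b) β≡i)

  F-reflection : (∀ x → η (- x) ≡ - η x) → ∀ r u x → F r (- u) x ≡ (- 1#) ^ r * F r u (- x)
  F-reflection η-odd r u x = sym (begin
    ε * ((- x) ^ r * (1# + u * η (- x)))   ≡⟨ cong₂ (λ p e → ε * (p * (1# + u * e))) ([-x]^r≡[-1]^r*x^r x r) (η-odd x) ⟩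
    ε * ((ε * x ^ r) * W)                  ≡⟨ solve 3 (λ ε p w → ε ⊕ ((ε ⊕ p) ⊕ w) ⊜ (ε ⊕ ε) ⊕ (p ⊕ w)) refl ε (x ^ r) W ⟩
    (ε * ε) * (x ^ r * W)                  ≡⟨ cong (_* (x ^ r * W)) ([-1]^r*[-1]^r≡1 r) ⟩
    1# * (x ^ r * W)                       ≡⟨ *-identityˡ (x ^ r * W) ⟩
    x ^ r * (1# + u * - η x)               ≡⟨ cong (λ e → x ^ r * (1# + e)) (trans (sym (-‿distribʳ-* u (η x))) (-‿distribˡ-* u (η x))) ⟩
    x ^ r * (1# + (- u) * η x)             ∎)
    where
    open ≡-Reasoning
    ε W : Carrier
    ε = (- 1#) ^ r
    W = 1# + u * - η x

  [-1]^[r+1]≡-[-1]^r : ∀ r → (- 1#) ^ (r +ℕ 1) ≡ - ((- 1#) ^ r)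
  [-1]^[r+1]≡-[-1]^r r = trans (cong ((- 1#) ^_) (ℕ.+-comm r 1)) (-1*x≈-x ((- 1#) ^ r))

m%4≡3⇒m≡1+2[1+2j] : ∀ m → m % 4 ≡ 3 → ∃[ j ] m ≡ suc (2 *ℕ suc (2 *ℕ j))
m%4≡3⇒m≡1+2[1+2j] m m%4≡3 = m / 4 , (begin
  m                                     ≡⟨ m≡m%n+[m/n]*n m 4 ⟩
  m % 4 +ℕ m / 4 *ℕ 4                   ≡⟨ cong (_+ℕ m / 4 *ℕ 4) m%4≡3 ⟩
  3 +ℕ m / 4 *ℕ 4                       ≡⟨ 3+4j≡1+2[1+2j] (m / 4) ⟩
  suc (2 *ℕ suc (2 *ℕ (m / 4)))         ∎)
  where
  open ≡-Reasoning
  3+4j≡1+2[1+2j] : ∀ j → 3 +ℕ j *ℕ 4 ≡ suc (2 *ℕ suc (2 *ℕ j))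
  3+4j≡1+2[1+2j] = solve-∀

lemma10 : (K : FiniteField) →
    let open FiniteField K in
    (∃[ p ] ∃[ k ] (Prime p × p % 2 ≡ 1 × order ≡ p ^ℕ k)) →
    order % 4 ≡ 3 →
    (r : ℕ) → 1 ≤ r → (u : Carrier) →
    ((a b : Carrier) → a ≢ 0# →
        δ (F r (- u)) a b ≡ δ (F r u) a (b * (((- 1#) ^ (r +ℕ 1)) ⁻¹)))
    × ((a b : Carrier) → a ≢ 0# →
        β (F r (- u)) a b ≡ β (F r u) a (b * (((- 1#) ^ r) ⁻¹)))
    × ((i : ℕ) → ω (F r (- u)) i ≡ ω (F r u) i)
    × ((i : ℕ) → ν (F r (- u)) i ≡ ν (F r u) i)
lemma10 K _ order%4≡3 r _ u =
    (λ a b _ → trans (δ-reflection a b) (cong (λ d → δ (F r u) a (b * d ⁻¹)) (sym ([-1]^[r+1]≡-[-1]^r K r))))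
  , (λ a b _ → β-reflection a b)
  , ω-reflection
  , ν-reflection
  where
  open FiniteField K
  order≡1+2[1+2j] : ∃[ j ] order ≡ suc (2 *ℕ suc (2 *ℕ j))
  order≡1+2[1+2j] = m%4≡3⇒m≡1+2[1+2j] order order%4≡3
  j : ℕ
  j = proj₁ order≡1+2[1+2j]
  open OddOrder K {h = suc (2 *ℕ j)} (proj₂ order≡1+2[1+2j])
  open Reflection K (F r (- u)) (F r u) (^-≢0 K r (-‿≢0 K (0≢1 ∘ sym)))
    (F-reflection K (η-odd ([-1]^[1+2j]≡-1 K j)) r u)
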